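{- Let $n \geq 2$ and consider the absent-minded passengers process with one absent-minded passenger: there are $n$ seats labelled $1,\dots,n$ and $n$ passengers labelled $1,\dots,n$, where the correct seat of passenger $i$ is seat $i$. Passengers board in the order $1,2,\dots,n$. Passenger $1$ chooses a seat uniformly at random among all $n$ seats. Each subsequent passenger $i \geq 2$ takes seat $i$ if it is still empty, and otherwise chooses a seat uniformly at random among the currently empty seats. Define the weight-enumerator $$F_n(w_1,\dots,w_n)=\sum_{\sigma} \Pr(\sigma)\prod_{i:\ \text{passenger } i \text{ is not in seat } i \text{ in } \sigma} w_i,$$ where the sum is over all final seating arrangements $\sigma$ and $\Pr(\sigma)$ is the probability that the process ends in $\sigma$. Then $$F_n(w_1,\dots,w_n)=\frac{1-w_1}{n}+\frac{w_1}{n!}\prod_{i=2}^{n}(w_i+n+1-i).$$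
   Context: $w_1,\dots,w_n$ are commuting indeterminates; $F_n$ is a multilinear polynomial in them whose coefficient of $w_{i_1}\cdots w_{i_l}$ is the probability that exactly the passengers $i_1,\dots,i_l$ end up in a seat other than their own. -}

module Defs where

open import Data.Bool using (if_then_else_)
open import Data.Nat as ℕ using (ℕ; zero; suc; _∸_; _!)
open import Data.Nat.Properties using (_!≢0)
open import Data.Integer using (+_)
open import Data.Fin using (Fin; zero; suc; toℕ; _≟_)
open import Data.List using (List; []; _∷_; _++_; [_]; map; concatMap; filter; length; foldr; zipWith; allFin)
import Data.List.Membership.DecPropositional as DecMem
open import Data.Product using (_×_; _,_)
open import Data.Rational using (ℚ; _+_; _*_; _-_; _/_; 0ℚ; 1ℚ)
open import Relation.Nullary using (yes; no; ¬?; does)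

Dist : Set → Set
Dist A = List (ℚ × A)

bind : {A B : Set} → Dist A → (A → Dist B) → Dist B
bind d f = concatMap (λ { (p , a) → map (λ { (q , b) → (p * q , b) }) (f a) }) d

-- uniform choice among the elements of a list (the elements here are distinct)
uniform : {A : Set} → List A → Dist A
uniform [] = []
uniform (x ∷ xs) = map (λ y → ((+ 1) / suc (length xs) , y)) (x ∷ xs)

-- Seats are Fin n; seat `zero` is seat 1, passenger `i : Fin n` has label toℕ i + 1
-- and correct seat i.  A (partial) outcome is the list of seats taken, in boarding
-- order, so the j-th entry is the seat of passenger j.
emptySeats : {n : ℕ} → List (Fin n) → List (Fin n)
emptySeats {n} taken = filter (λ s → ¬? (DecMem._∈?_ (_≟_ {n}) s taken)) (allFin n)

later : {n : ℕ} → List (Fin n) → List (Fin n) → Dist (List (Fin n))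
later [] taken = (1ℚ , taken) ∷ []
later {n} (i ∷ is) taken with DecMem._∈?_ (_≟_ {n}) i taken
... | no _ = later is (taken ++ [ i ])
... | yes _ = bind (uniform (emptySeats taken)) (λ s → later is (taken ++ [ s ]))

process : (n : ℕ) → Dist (List (Fin n))
process zero = (1ℚ , []) ∷ []
process (suc m) =
  bind (uniform (allFin (suc m))) (λ s → later (map suc (allFin m)) [ s ])

prodℚ : List ℚ → ℚ
prodℚ = foldr _*_ 1ℚ

weight : {n : ℕ} → (Fin n → ℚ) → List (Fin n) → ℚ
weight {n} w σ =
  prodℚ (zipWith (λ i s → if does (i ≟ s) then 1ℚ else w i) (allFin n) σ)

F : (n : ℕ) → (Fin n → ℚ) → ℚ
F n w = foldr (λ { (p , σ) acc → p * weight w σ + acc }) 0ℚ (process n)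

ℕtoℚ : ℕ → ℚ
ℕtoℚ k = (+ k) / 1

-- (1 - w_1)/n + w_1/n! * ∏_{i=2}^{n} (w_i + n + 1 - i)
-- (passenger suc j has label i = toℕ j + 2, so n + 1 - i = (n + 1) ∸ (toℕ j + 2))
RHS : (n : ℕ) → (Fin n → ℚ) → ℚ
RHS zero w = 0ℚ
RHS (suc m) w =
  (1ℚ - w zero) * ((+ 1) / suc m)
  + (w zero * (_/_ (+ 1) ((suc m) !) ⦃ suc m !≢0 ⦄))
    * prodℚ (map (λ j → w (suc j) + ℕtoℚ ((suc m ℕ.+ 1) ∸ (toℕ j ℕ.+ 2))) (allFin m))

module Submission where

-- Once passenger 1 has sat down, at most one passenger at a time is displaced: if passenger 1 took
-- seat t > 1, passengers 2, …, t − 1 sit correctly and passenger t picks uniformly among seat 1 and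
-- the seats of the n − t passengers after him; seat 1 ends all displacements, seat s makes s the
-- next displaced passenger. So the expected weight E_t still to come once t is displaced satisfies
-- E_t = w_t / (n + 1 − t) · (1 + Σ_{s>t} E_s), and P_t = ∏_{s>t} (1 + w_s / (n + 1 − s)) telescopes
-- to 1 + Σ_{s>t} E_s, whence E_t = w_t P_t / (n + 1 − t). Averaging over passenger 1's choice gives
-- F_n = (1 + w_1 (P_1 − 1)) / n, and P_1 = ∏_{i≥2} (w_i + n + 1 − i) / (n − 1)!.

open import Defs
open import Data.Bool using (if_then_else_)
open import Data.Empty using (⊥-elim)
open import Data.Fin using (Fin; zero; suc; toℕ; _≟_)
open import Data.Integer as ℤ using (+_)
import Data.Integer.Properties as ℤP
open import Data.List using (List; []; _∷_; _++_; [_]; map; filter; length; foldr; zipWith; tabulate; allFin)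
import Data.List.Properties as LP
open import Data.List.Membership.Propositional using (_∈_; _∉_)
open import Data.List.Membership.Propositional.Properties using (∈-++⁺ˡ; ∈-++⁺ʳ; ∈-++⁻)
import Data.List.Membership.DecPropositional as DecMem
open import Data.List.Relation.Binary.Subset.Propositional using (_⊆_)
open import Data.List.Relation.Unary.Any using (here; there)
open import Data.List.Relation.Unary.All as All using (All)
open import Data.List.Relation.Unary.All.Properties using (All¬⇒¬Any)
open import Data.List.Relation.Unary.AllPairs using (_∷_)
open import Data.List.Relation.Unary.Unique.Propositional using (Unique)
open import Data.List.Relation.Unary.Unique.Propositional.Properties using (allFin⁺)
open import Data.Nat as ℕ using (ℕ; zero; suc; _≤_; _∸_; _!)
import Data.Nat.Properties as ℕP
open import Data.Nat.Properties using (_!≢0)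
open import Data.Nat.Tactic.RingSolver using (solve-∀)
open import Data.Product using (_×_; _,_)
open import Data.Rational using (ℚ; _+_; _*_; _-_; _/_; 0ℚ; 1ℚ; toℚᵘ)
open import Data.Rational.Properties
  using (+-identityˡ; +-identityʳ; +-assoc; *-identityˡ; *-identityʳ; *-zeroʳ; *-assoc; *-distribˡ-+;
         /-cong; toℚᵘ-injective; toℚᵘ-fromℚᵘ; toℚᵘ-homo-*)
open import Data.Rational.Solver using (module +-*-Solver)
open +-*-Solver using (solve; _:=_; _:+_; _:*_; _:-_; con)
import Data.Rational.Unnormalised as ℚᵘ
import Data.Rational.Unnormalised.Properties as ℚᵘ
open import Data.Sum using (inj₁; inj₂)
open import Function using (_∘_; id; it)
open import Relation.Binary.PropositionalEquality
  using (_≡_; _≢_; refl; sym; trans; cong; cong₂; subst; module ≡-Reasoning)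
open import Relation.Nullary using (Dec; yes; no; does; ¬?)
open import Relation.Nullary.Decidable using (dec-true; dec-false)

expect : {A : Set} → Dist A → (A → ℚ) → ℚ
expect [] g = 0ℚ
expect ((p , a) ∷ d) g = p * g a + expect d g

sumBy : {A : Set} → (A → ℚ) → List A → ℚ
sumBy f [] = 0ℚ
sumBy f (x ∷ xs) = f x + sumBy f xs

-- Stated for any f (resp. h) that computes like the pattern lambda in F (resp. bind),
-- which cannot be referred to directly.
foldr-expect : {A : Set} {f : ℚ × A → ℚ → ℚ} (g : A → ℚ) → (∀ p a acc → f (p , a) acc ≡ p * g a + acc) →
               ∀ d → foldr f 0ℚ d ≡ expect d g
foldr-expect g f≗ [] = refl
foldr-expect g f≗ ((p , a) ∷ d) = trans (f≗ p a _) (cong (_+_ (p * g a)) (foldr-expect g f≗ d))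

expect-++ : {A : Set} (d e : Dist A) (g : A → ℚ) → expect (d ++ e) g ≡ expect d g + expect e g
expect-++ [] e g = sym (+-identityˡ (expect e g))
expect-++ ((p , a) ∷ d) e g = trans (cong (_+_ (p * g a)) (expect-++ d e g)) (sym (+-assoc (p * g a) _ _))

expect-scale : {A : Set} {h : ℚ × A → ℚ × A} (p : ℚ) (g : A → ℚ) → (∀ q a → h (q , a) ≡ (p * q , a)) →
               ∀ d → expect (map h d) g ≡ p * expect d g
expect-scale p g h≗ [] = sym (*-zeroʳ p)
expect-scale p g h≗ ((q , a) ∷ d) rewrite h≗ q a =
  trans (cong₂ _+_ (*-assoc p q (g a)) (expect-scale p g h≗ d)) (sym (*-distribˡ-+ p _ _))

expect-bind : {A B : Set} (d : Dist A) (f : A → Dist B) (g : B → ℚ) →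
              expect (bind d f) g ≡ expect d (λ a → expect (f a) g)
expect-bind [] f g = refl
expect-bind ((p , a) ∷ d) f g =
  trans (expect-++ (map _ (f a)) (bind d f) g) (cong₂ _+_ (expect-scale p g (λ _ _ → refl) (f a)) (expect-bind d f g))

-- the probability of each outcome of uniform (x ∷ xs)
uniformProb : {A : Set} → List A → ℚ
uniformProb xs = (+ 1) / suc (length xs)

expect-uniform : {A : Set} (x : A) (xs : List A) (g : A → ℚ) →
                 expect (uniform (x ∷ xs)) g ≡ uniformProb xs * sumBy g (x ∷ xs)
expect-uniform x xs g = expect-const (x ∷ xs)
  where
  expect-const : ∀ ys → expect (map (λ y → (uniformProb xs , y)) ys) g ≡ uniformProb xs * sumBy g ys
  expect-const [] = sym (*-zeroʳ (uniformProb xs))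
  expect-const (y ∷ ys) =
    trans (cong (_+_ (uniformProb xs * g y)) (expect-const ys)) (sym (*-distribˡ-+ (uniformProb xs) (g y) (sumBy g ys)))

sumBy-cong-∈ : {A : Set} {f g : A → ℚ} → ∀ xs → (∀ {x} → x ∈ xs → f x ≡ g x) → sumBy f xs ≡ sumBy g xs
sumBy-cong-∈ [] f≗g = refl
sumBy-cong-∈ (x ∷ xs) f≗g = cong₂ _+_ (f≗g (here refl)) (sumBy-cong-∈ xs (f≗g ∘ there))

sumBy-*ˡ : {A : Set} (k : ℚ) (f : A → ℚ) → ∀ xs → sumBy (λ x → k * f x) xs ≡ k * sumBy f xs
sumBy-*ˡ k f [] = sym (*-zeroʳ k)
sumBy-*ˡ k f (x ∷ xs) = trans (cong (_+_ (k * f x)) (sumBy-*ˡ k f xs)) (sym (*-distribˡ-+ k (f x) (sumBy f xs)))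

toℚᵘ-/ : ∀ i d → toℚᵘ (i / suc d) ℚᵘ.≃ ℚᵘ.mkℚᵘ i d
toℚᵘ-/ i d = toℚᵘ-fromℚᵘ (ℚᵘ.mkℚᵘ i d)

ℕtoℚ-* : ∀ a b → ℕtoℚ (a ℕ.* b) ≡ ℕtoℚ a * ℕtoℚ b
ℕtoℚ-* a b = toℚᵘ-injective (begin
  toℚᵘ (ℕtoℚ (a ℕ.* b))                   ≈⟨ toℚᵘ-/ (+ (a ℕ.* b)) 0 ⟩
  ℚᵘ.mkℚᵘ (+ (a ℕ.* b)) 0                 ≈⟨ ℚᵘ.*≡* (cong (λ i → i ℤ.* + 1) (ℤP.pos-* a b)) ⟩
  ℚᵘ.mkℚᵘ (+ a) 0 ℚᵘ.* ℚᵘ.mkℚᵘ (+ b) 0    ≈⟨ ℚᵘ.≃-sym (ℚᵘ.*-cong (toℚᵘ-/ (+ a) 0) (toℚᵘ-/ (+ b) 0)) ⟩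
  toℚᵘ (ℕtoℚ a) ℚᵘ.* toℚᵘ (ℕtoℚ b)        ≈⟨ ℚᵘ.≃-sym (toℚᵘ-homo-* (ℕtoℚ a) (ℕtoℚ b)) ⟩
  toℚᵘ (ℕtoℚ a * ℕtoℚ b)                  ∎)
  where open ℚᵘ.≃-Reasoning

1/[m*n]*n≡1/m : ∀ a b .{{_ : ℕ.NonZero a}} .{{_ : ℕ.NonZero b}} →
                _/_ (+ 1) (a ℕ.* b) ⦃ ℕP.m*n≢0 a b ⦄ * ℕtoℚ b ≡ (+ 1) / a
1/[m*n]*n≡1/m (suc a) (suc b) = toℚᵘ-injective (begin
  toℚᵘ ((+ 1) / (suc a ℕ.* suc b) * ℕtoℚ (suc b))
    ≈⟨ toℚᵘ-homo-* ((+ 1) / (suc a ℕ.* suc b)) (ℕtoℚ (suc b)) ⟩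
  toℚᵘ ((+ 1) / (suc a ℕ.* suc b)) ℚᵘ.* toℚᵘ (ℕtoℚ (suc b))
    ≈⟨ ℚᵘ.*-cong (toℚᵘ-/ (+ 1) (b ℕ.+ a ℕ.* suc b)) (toℚᵘ-/ (+ suc b) 0) ⟩
  ℚᵘ.mkℚᵘ (+ 1) (b ℕ.+ a ℕ.* suc b) ℚᵘ.* ℚᵘ.mkℚᵘ (+ suc b) 0
    ≈⟨ ℚᵘ.*≡* (cong (λ x → + suc x) (cross a b)) ⟩
  ℚᵘ.mkℚᵘ (+ 1) a
    ≈⟨ ℚᵘ.≃-sym (toℚᵘ-/ (+ 1) a) ⟩
  toℚᵘ ((+ 1) / suc a) ∎)
  where
  open ℚᵘ.≃-Reasoning
  -- the cross-multiplication condition of ℚᵘ.*≡*, as it normalises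
  cross : ∀ a b → a ℕ.+ (b ℕ.+ 0) ℕ.* suc a ≡ (b ℕ.+ a ℕ.* suc b) ℕ.* 1 ℕ.+ 0
  cross = solve-∀

1/n*n≡1 : ∀ n .{{_ : ℕ.NonZero n}} → (+ 1) / n * ℕtoℚ n ≡ 1ℚ
1/n*n≡1 n = trans (cong (_* ℕtoℚ n) 1/n≡1/[1*n]) (1/[m*n]*n≡1/m 1 n)
  where
  1/n≡1/[1*n] : (+ 1) / n ≡ _/_ (+ 1) (1 ℕ.* n) ⦃ ℕP.m*n≢0 1 n ⦄
  1/n≡1/[1*n] = /-cong {+ 1} {n} {+ 1} {1 ℕ.* n} ⦃ it ⦄ ⦃ ℕP.m*n≢0 1 n ⦄ refl (sym (ℕP.*-identityˡ n))

-- For xs the passengers after t, tailProduct w xs is P_t and tailSum w xs is Σ_{s>t} E_s.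
module _ {A : Set} (u : A → ℚ) where

  tailProduct : List A → ℚ
  tailProduct [] = 1ℚ
  tailProduct (x ∷ r) = (1ℚ + u x * uniformProb r) * tailProduct r

  tailSum : List A → ℚ
  tailSum [] = 0ℚ
  tailSum (x ∷ r) = u x * uniformProb r * tailProduct r + tailSum r

  tailProduct≡1+tailSum : ∀ xs → tailProduct xs ≡ 1ℚ + tailSum xs
  tailProduct≡1+tailSum [] = sym (+-identityʳ 1ℚ)
  tailProduct≡1+tailSum (x ∷ r) = begin
    (1ℚ + a) * tailProduct r
      ≡⟨ solve 2 (λ a P → (con 1ℚ :+ a) :* P := P :+ a :* P) refl a (tailProduct r) ⟩
    tailProduct r + a * tailProduct r
      ≡⟨ cong (_+ a * tailProduct r) (tailProduct≡1+tailSum r) ⟩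
    1ℚ + tailSum r + a * tailProduct r
      ≡⟨ solve 3 (λ S a P → con 1ℚ :+ S :+ a :* P := con 1ℚ :+ (a :* P :+ S)) refl (tailSum r) a (tailProduct r) ⟩
    1ℚ + tailSum (x ∷ r) ∎
    where
    open ≡-Reasoning
    a = u x * uniformProb r

  tailProduct-tabulate : ∀ k (f : Fin k → A) →
    tailProduct (tabulate f) * ℕtoℚ (k !) ≡ prodℚ (tabulate (λ j → u (f j) + ℕtoℚ (k ∸ toℕ j)))
  tailProduct-tabulate zero f = *-identityˡ 1ℚ
  tailProduct-tabulate (suc k) f = begin
    (1ℚ + u x * c) * tailProduct r * ℕtoℚ (suc k ℕ.* k !)
      ≡⟨ cong (_*_ ((1ℚ + u x * c) * tailProduct r)) (ℕtoℚ-* (suc k) (k !)) ⟩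
    (1ℚ + u x * c) * tailProduct r * (N * ℕtoℚ (k !))
      ≡⟨ solve 5 (λ a c P N M → (con 1ℚ :+ a :* c) :* P :* (N :* M) := (a :* (c :* N) :+ N) :* (P :* M))
                 refl (u x) c (tailProduct r) N (ℕtoℚ (k !)) ⟩
    (u x * (c * N) + N) * (tailProduct r * ℕtoℚ (k !))
      ≡⟨ cong₂ (λ y z → (u x * y + N) * z) c*N≡1 (tailProduct-tabulate k (f ∘ suc)) ⟩
    (u x * 1ℚ + N) * prodℚ (tabulate g)
      ≡⟨ cong (λ y → (y + N) * prodℚ (tabulate g)) (*-identityʳ (u x)) ⟩
    (u x + N) * prodℚ (tabulate g) ∎
    where
    open ≡-Reasoning
    x = f zero
    r = tabulate (f ∘ suc)
    c = uniformProb r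
    N = ℕtoℚ (suc k)
    g = λ j → u (f (suc j)) + ℕtoℚ (k ∸ toℕ j)
    c*N≡1 : c * N ≡ 1ℚ
    c*N≡1 = trans (cong (λ l → (+ 1) / suc l * N) (LP.length-tabulate (f ∘ suc))) (1/n*n≡1 (suc k))

prodℚ-++-[] : ∀ xs x → prodℚ (xs ++ [ x ]) ≡ prodℚ xs * x
prodℚ-++-[] [] x = trans (*-identityʳ x) (sym (*-identityˡ x))
prodℚ-++-[] (y ∷ xs) x = trans (cong (y *_) (prodℚ-++-[] xs x)) (sym (*-assoc y (prodℚ xs) x))

zipWith-++-[] : {A B C : Set} (f : A → B → C) → ∀ xs ys {x y zs} → length xs ≡ length ys →
                zipWith f (xs ++ x ∷ zs) (ys ++ [ y ]) ≡ zipWith f (xs ++ x ∷ zs) ys ++ [ f x y ]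
zipWith-++-[] f [] [] {x} {y} {zs} _ = cong (f x y ∷_) (LP.zipWith-zeroʳ f zs)
zipWith-++-[] f (a ∷ xs) (b ∷ ys) eq = cong (f a b ∷_) (zipWith-++-[] f xs ys (ℕP.suc-injective eq))

length-++-[] : {A : Set} (xs : List A) (x : A) → length (xs ++ [ x ]) ≡ suc (length xs)
length-++-[] xs x = trans (LP.length-++ xs) (ℕP.+-comm (length xs) 1)

Unique-∷⁻ : {A : Set} {x : A} {xs : List A} → Unique (x ∷ xs) → x ∉ xs
Unique-∷⁻ (x≢xs ∷ _) = All¬⇒¬Any x≢xs

Unique-++⁻ʳ : {A : Set} (xs : List A) {ys : List A} → Unique (xs ++ ys) → Unique ys
Unique-++⁻ʳ [] u = u
Unique-++⁻ʳ (x ∷ xs) (_ ∷ u) = Unique-++⁻ʳ xs u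

Unique-++-disjoint : {A : Set} (xs : List A) {ys : List A} {x : A} → Unique (xs ++ ys) → x ∈ xs → x ∉ ys
Unique-++-disjoint (x ∷ xs) u (here refl) x∈ys = Unique-∷⁻ u (∈-++⁺ʳ xs x∈ys)
Unique-++-disjoint (y ∷ xs) (_ ∷ u) (there x∈xs) = Unique-++-disjoint xs u x∈xs

module Boarding {m : ℕ} (w : Fin (suc m) → ℚ) where

  Seat : Set
  Seat = Fin (suc m)

  seatWeight : Seat → Seat → ℚ
  seatWeight i s = if does (i ≟ s) then 1ℚ else w i

  seatWeight-self : ∀ p → seatWeight p p ≡ 1ℚ
  seatWeight-self p rewrite dec-true (p ≟ p) refl = refl

  seatWeight-other : ∀ {p s} → p ≢ s → seatWeight p s ≡ w p
  seatWeight-other {p} {s} p≢s rewrite dec-false (p ≟ s) p≢s = refl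

  -- Expected weight of the passengers is still to board, given that seat t is occupied out of turn
  -- (E_t above when is starts with t); t = zero means that nobody is displaced any more.
  expectedRest : Seat → List Seat → ℚ
  expectedRest t [] = 1ℚ
  expectedRest t (p ∷ r) = if does (p ≟ t) then w t * uniformProb r * tailProduct w r else expectedRest t r

  expectedRest-here : ∀ t r → expectedRest t (t ∷ r) ≡ w t * uniformProb r * tailProduct w r
  expectedRest-here t r rewrite dec-true (t ≟ t) refl = refl

  expectedRest-skip : ∀ {p t} r → p ≢ t → expectedRest t (p ∷ r) ≡ expectedRest t r
  expectedRest-skip {p} {t} r p≢t rewrite dec-false (p ≟ t) p≢t = refl

  expectedRest-absent : ∀ {t} is → t ∉ is → expectedRest t is ≡ 1ℚ
  expectedRest-absent [] _ = refl
  expectedRest-absent (p ∷ r) t∉ = trans (expectedRest-skip r (t∉ ∘ here ∘ sym)) (expectedRest-absent r (t∉ ∘ there))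

  sumBy-expectedRest : ∀ is → Unique is → sumBy (λ s → expectedRest s is) is ≡ tailSum w is
  sumBy-expectedRest [] _ = refl
  sumBy-expectedRest (x ∷ r) (x≢r ∷ u) = cong₂ _+_ (expectedRest-here x r) (begin
    sumBy (λ s → expectedRest s (x ∷ r)) r ≡⟨ sumBy-cong-∈ r (λ s∈r → expectedRest-skip r (All.lookup x≢r s∈r)) ⟩
    sumBy (λ s → expectedRest s r) r       ≡⟨ sumBy-expectedRest r u ⟩
    tailSum w r                            ∎)
    where open ≡-Reasoning

  sumBy-expectedRest-∷ : ∀ {z} is → z ∉ is → Unique is → sumBy (λ s → expectedRest s is) (z ∷ is) ≡ tailProduct w is
  sumBy-expectedRest-∷ {z} is z∉is u = begin
    expectedRest z is + sumBy (λ s → expectedRest s is) is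
      ≡⟨ cong₂ _+_ (expectedRest-absent is z∉is) (sumBy-expectedRest is u) ⟩
    1ℚ + tailSum w is
      ≡⟨ sym (tailProduct≡1+tailSum w is) ⟩
    tailProduct w is ∎
    where open ≡-Reasoning

  -- The state once the passengers before is have boarded: done lists those other than passenger 1,
  -- and the occupied seats are theirs together with t.
  record Boarded (taken done is : List Seat) (t : Seat) : Set where
    field
      layout : allFin (suc m) ≡ zero ∷ done ++ is
      size   : length taken ≡ suc (length done)
      taken⊆ : taken ⊆ t ∷ done
      ⊆taken : t ∷ done ⊆ taken

    unique : Unique (zero ∷ done ++ is)
    unique = subst Unique layout (allFin⁺ (suc m))

    unique-is : Unique is
    unique-is = Unique-++⁻ʳ (zero ∷ done) unique

    zero∉ : zero ∉ done ++ is
    zero∉ = Unique-∷⁻ unique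

    ∉done : ∀ {s} → s ∈ is → s ∉ done
    ∉done s∈is s∈done = Unique-++-disjoint done (Unique-++⁻ʳ [ zero ] unique) s∈done s∈is

    ∉taken : ∀ {s} → s ≢ t → s ∉ done → s ∉ taken
    ∉taken s≢t s∉done s∈taken with taken⊆ s∈taken
    ... | here s≡t = s≢t s≡t
    ... | there s∈done = s∉done s∈done

  open Boarded

  occupied⇒≡t : ∀ {taken done p r t} → Boarded taken done (p ∷ r) t → p ∈ taken → p ≡ t
  occupied⇒≡t B p∈taken with taken⊆ B p∈taken
  ... | here p≡t = p≡t
  ... | there p∈done = ⊥-elim (∉done B (here refl) p∈done)

  seatOwn : ∀ {taken done p r t} → Boarded taken done (p ∷ r) t → p ∉ taken →
            Boarded (taken ++ [ p ]) (done ++ [ p ]) r t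
  seatOwn {taken} {done} {p} {r} {t} B p∉taken = record
    { layout = trans (layout B) (cong (zero ∷_) (sym (LP.++-assoc done [ p ] r)))
    ; size   = trans (length-++-[] taken p) (cong suc (trans (size B) (sym (length-++-[] done p))))
    ; taken⊆ = sub
    ; ⊆taken = sup
    }
    where
    sub : taken ++ [ p ] ⊆ t ∷ done ++ [ p ]
    sub x∈ with ∈-++⁻ taken x∈
    ... | inj₁ x∈taken with taken⊆ B x∈taken
    ...   | here x≡t = here x≡t
    ...   | there x∈done = there (∈-++⁺ˡ x∈done)
    sub x∈ | inj₂ x∈[p] = there (∈-++⁺ʳ done x∈[p])
    sup : t ∷ done ++ [ p ] ⊆ taken ++ [ p ]
    sup (here x≡t) = ∈-++⁺ˡ (⊆taken B (here x≡t))
    sup (there x∈) with ∈-++⁻ done x∈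
    ... | inj₁ x∈done = ∈-++⁺ˡ (⊆taken B (there x∈done))
    ... | inj₂ x∈[p] = ∈-++⁺ʳ taken x∈[p]

  bump : ∀ {taken done r t} → Boarded taken done (t ∷ r) t → (s : Seat) →
         Boarded (taken ++ [ s ]) (done ++ [ t ]) r s
  bump {taken} {done} {r} {t} B s = record
    { layout = trans (layout B) (cong (zero ∷_) (sym (LP.++-assoc done [ t ] r)))
    ; size   = trans (length-++-[] taken s) (cong suc (trans (size B) (sym (length-++-[] done t))))
    ; taken⊆ = sub
    ; ⊆taken = sup
    }
    where
    sub : taken ++ [ s ] ⊆ s ∷ done ++ [ t ]
    sub x∈ with ∈-++⁻ taken x∈
    ... | inj₁ x∈taken with taken⊆ B x∈taken
    ...   | here x≡t = there (∈-++⁺ʳ done (here x≡t))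
    ...   | there x∈done = there (∈-++⁺ˡ x∈done)
    sub x∈ | inj₂ (here x≡s) = here x≡s
    sup : s ∷ done ++ [ t ] ⊆ taken ++ [ s ]
    sup (here x≡s) = ∈-++⁺ʳ taken (here x≡s)
    sup (there x∈) with ∈-++⁻ done x∈
    ... | inj₁ x∈done = ∈-++⁺ˡ (⊆taken B (there x∈done))
    ... | inj₂ (here x≡t) = ∈-++⁺ˡ (⊆taken B (here x≡t))

  weight-++-[] : ∀ {taken done p r t} → Boarded taken done (p ∷ r) t → ∀ s →
                 weight w (taken ++ [ s ]) ≡ weight w taken * seatWeight p s
  weight-++-[] {taken} {done} {p} {r} B s = begin
    prodℚ (zipWith seatWeight (allFin (suc m)) (taken ++ [ s ]))
      ≡⟨ cong (λ l → prodℚ (zipWith seatWeight l (taken ++ [ s ]))) (layout B) ⟩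
    prodℚ (zipWith seatWeight seats (taken ++ [ s ]))
      ≡⟨ cong prodℚ (zipWith-++-[] seatWeight (zero ∷ done) taken (sym (size B))) ⟩
    prodℚ (zipWith seatWeight seats taken ++ [ seatWeight p s ])
      ≡⟨ prodℚ-++-[] (zipWith seatWeight seats taken) (seatWeight p s) ⟩
    prodℚ (zipWith seatWeight seats taken) * seatWeight p s
      ≡⟨ cong (λ l → prodℚ (zipWith seatWeight l taken) * seatWeight p s) (sym (layout B)) ⟩
    weight w taken * seatWeight p s ∎
    where
    open ≡-Reasoning
    seats = zero ∷ done ++ p ∷ r

  emptySeats-bump : ∀ {taken done r t} → Boarded taken done (t ∷ r) t → emptySeats taken ≡ zero ∷ r
  emptySeats-bump {taken} {done} {r} {t} B = begin
    filter free (allFin (suc m))                   ≡⟨ cong (filter free) (layout B) ⟩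
    filter free (zero ∷ done ++ t ∷ r)             ≡⟨ LP.filter-accept free zero-free ⟩
    zero ∷ filter free (done ++ t ∷ r)             ≡⟨ cong (zero ∷_) (LP.filter-++ free done (t ∷ r)) ⟩
    zero ∷ filter free done ++ filter free (t ∷ r) ≡⟨ cong₂ (λ xs ys → zero ∷ xs ++ ys) done-taken t-taken ⟩
    zero ∷ filter free r                           ≡⟨ cong (zero ∷_) (LP.filter-all free r-free) ⟩
    zero ∷ r                                       ∎
    where
    open ≡-Reasoning
    free : (s : Seat) → Dec (s ∉ taken)
    free s = ¬? (DecMem._∈?_ _≟_ s taken)
    zero-free : zero ∉ taken
    zero-free = ∉taken B (λ z≡t → zero∉ B (∈-++⁺ʳ done (here z≡t))) (zero∉ B ∘ ∈-++⁺ˡ)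
    done-taken : filter free done ≡ []
    done-taken = LP.filter-none free (All.tabulate λ s∈done s∉taken → s∉taken (⊆taken B (there s∈done)))
    t-taken : filter free (t ∷ r) ≡ filter free r
    t-taken = LP.filter-reject free (λ t∉taken → t∉taken (⊆taken B (here refl)))
    r-free : All (_∉ taken) r
    r-free = All.tabulate λ s∈r → ∉taken B (λ { refl → Unique-∷⁻ (unique-is B) s∈r }) (∉done B (there s∈r))

  expect-bump : ∀ {taken done r t} → Boarded taken done (t ∷ r) t →
    (∀ s → expect (later r (taken ++ [ s ])) (weight w) ≡ weight w (taken ++ [ s ]) * expectedRest s r) →
    expect (bind (uniform (emptySeats taken)) (λ s → later r (taken ++ [ s ]))) (weight w)
      ≡ weight w taken * expectedRest t (t ∷ r)
  expect-bump {taken} {done} {r} {t} B expect-next = begin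
    expect (bind (uniform (emptySeats taken)) next) (weight w)
      ≡⟨ expect-bind (uniform (emptySeats taken)) next (weight w) ⟩
    expect (uniform (emptySeats taken)) value
      ≡⟨ cong (λ l → expect (uniform l) value) (emptySeats-bump B) ⟩
    expect (uniform (zero ∷ r)) value
      ≡⟨ expect-uniform zero r value ⟩
    uniformProb r * sumBy value (zero ∷ r)
      ≡⟨ cong (uniformProb r *_) (sumBy-cong-∈ (zero ∷ r) value-∈) ⟩
    uniformProb r * sumBy (λ s → W * w t * expectedRest s r) (zero ∷ r)
      ≡⟨ cong (uniformProb r *_) (sumBy-*ˡ (W * w t) (λ s → expectedRest s r) (zero ∷ r)) ⟩
    uniformProb r * (W * w t * sumBy (λ s → expectedRest s r) (zero ∷ r))
      ≡⟨ cong (λ z → uniformProb r * (W * w t * z)) (sumBy-expectedRest-∷ r zero∉r unique-r) ⟩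
    uniformProb r * (W * w t * tailProduct w r)
      ≡⟨ solve 4 (λ c W a P → c :* (W :* a :* P) := W :* (a :* c :* P)) refl (uniformProb r) W (w t) (tailProduct w r) ⟩
    W * (w t * uniformProb r * tailProduct w r)
      ≡⟨ cong (W *_) (sym (expectedRest-here t r)) ⟩
    W * expectedRest t (t ∷ r) ∎
    where
    open ≡-Reasoning
    W = weight w taken
    next = λ s → later r (taken ++ [ s ])
    value = λ s → expect (next s) (weight w)
    zero∉r : zero ∉ r
    zero∉r = zero∉ B ∘ ∈-++⁺ʳ done ∘ there
    unique-r : Unique r
    unique-r = Unique-++⁻ʳ [ t ] (unique-is B)
    t≢ : ∀ {s} → s ∈ zero ∷ r → t ≢ s
    t≢ (here refl) t≡zero = zero∉ B (∈-++⁺ʳ done (here (sym t≡zero)))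
    t≢ (there s∈r) refl = Unique-∷⁻ (unique-is B) s∈r
    value-∈ : ∀ {s} → s ∈ zero ∷ r → value s ≡ W * w t * expectedRest s r
    value-∈ {s} s∈ = trans (expect-next s)
      (cong (_* expectedRest s r) (trans (weight-++-[] B s) (cong (W *_) (seatWeight-other (t≢ s∈)))))

  expect-later : ∀ is {taken done t} → Boarded taken done is t →
                 expect (later is taken) (weight w) ≡ weight w taken * expectedRest t is
  expect-later [] {taken} _ =
    trans (+-identityʳ (1ℚ * weight w taken)) (trans (*-identityˡ (weight w taken)) (sym (*-identityʳ (weight w taken))))
  expect-later (p ∷ r) {taken} {done} {t} B with DecMem._∈?_ _≟_ p taken
  ... | yes p∈taken with refl ← occupied⇒≡t B p∈taken = expect-bump B (λ s → expect-later r (bump B s))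
  ... | no p∉taken = begin
    expect (later r (taken ++ [ p ])) (weight w)  ≡⟨ expect-later r (seatOwn B p∉taken) ⟩
    weight w (taken ++ [ p ]) * expectedRest t r   ≡⟨ cong₂ _*_ seated (sym (expectedRest-skip r p≢t)) ⟩
    weight w taken * expectedRest t (p ∷ r)        ∎
    where
    open ≡-Reasoning
    p≢t : p ≢ t
    p≢t p≡t = p∉taken (⊆taken B (here p≡t))
    seated : weight w (taken ++ [ p ]) ≡ weight w taken
    seated = trans (weight-++-[] B p) (trans (cong (weight w taken *_) (seatWeight-self p)) (*-identityʳ (weight w taken)))

  passengers : List Seat
  passengers = map suc (allFin m)

  start : ∀ s → Boarded [ s ] [] passengers s
  start s = record
    { layout = cong (zero ∷_) (sym (LP.map-tabulate id suc))
    ; size   = refl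
    ; taken⊆ = id
    ; ⊆taken = id
    }

  weight-[] : ∀ s → weight w [ s ] ≡ seatWeight zero s
  weight-[] s =
    trans (cong (λ l → prodℚ (seatWeight zero s ∷ l)) (LP.zipWith-zeroʳ seatWeight (tabulate suc)))
          (*-identityʳ (seatWeight zero s))

  expect-process : expect (process (suc m)) (weight w) ≡ (+ 1) / suc m * (1ℚ + w zero * tailSum w passengers)
  expect-process = begin
    expect (bind (uniform (allFin (suc m))) first) (weight w)
      ≡⟨ expect-bind (uniform (allFin (suc m))) first (weight w) ⟩
    expect (uniform (allFin (suc m))) value
      ≡⟨ cong (λ l → expect (uniform l) value) (layout (start zero)) ⟩
    expect (uniform (zero ∷ passengers)) value
      ≡⟨ expect-uniform zero passengers value ⟩
    uniformProb passengers * (value zero + sumBy value passengers)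
      ≡⟨ cong₂ (λ c v → c * (v + sumBy value passengers)) uniformProb-passengers value-zero ⟩
    c * (1ℚ + sumBy value passengers)
      ≡⟨ cong (λ v → c * (1ℚ + v)) (sumBy-cong-∈ passengers value-∈) ⟩
    c * (1ℚ + sumBy (λ s → w zero * expectedRest s passengers) passengers)
      ≡⟨ cong (λ v → c * (1ℚ + v)) (sumBy-*ˡ (w zero) (λ s → expectedRest s passengers) passengers) ⟩
    c * (1ℚ + w zero * sumBy (λ s → expectedRest s passengers) passengers)
      ≡⟨ cong (λ v → c * (1ℚ + w zero * v)) (sumBy-expectedRest passengers (unique-is (start zero))) ⟩
    c * (1ℚ + w zero * tailSum w passengers) ∎
    where
    open ≡-Reasoning
    c = (+ 1) / suc m
    first = λ s → later passengers [ s ]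
    value = λ s → expect (first s) (weight w)
    uniformProb-passengers : uniformProb passengers ≡ c
    uniformProb-passengers = cong (λ k → (+ 1) / suc k) (trans (LP.length-map suc (allFin m)) (LP.length-tabulate {n = m} id))
    value-zero : value zero ≡ 1ℚ
    value-zero = begin
      value zero
        ≡⟨ expect-later passengers (start zero) ⟩
      weight w [ zero ] * expectedRest zero passengers
        ≡⟨ cong₂ _*_ (weight-[] zero) (expectedRest-absent passengers (zero∉ (start zero))) ⟩
      1ℚ * 1ℚ
        ≡⟨ *-identityˡ 1ℚ ⟩
      1ℚ ∎
    value-∈ : ∀ {s} → s ∈ passengers → value s ≡ w zero * expectedRest s passengers
    value-∈ {s} s∈ = trans (expect-later passengers (start s))
      (cong (_* expectedRest s passengers) (trans (weight-[] s) (seatWeight-other {s = s} λ { refl → zero∉ (start s) s∈ })))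

  tailProduct-passengers : tailProduct w passengers * ℕtoℚ (m !)
    ≡ prodℚ (map (λ j → w (suc j) + ℕtoℚ ((suc m ℕ.+ 1) ∸ (toℕ j ℕ.+ 2))) (allFin m))
  tailProduct-passengers = begin
    tailProduct w (map suc (allFin m)) * ℕtoℚ (m !)
      ≡⟨ cong (λ l → tailProduct w l * ℕtoℚ (m !)) (LP.map-tabulate id suc) ⟩
    tailProduct w (tabulate suc) * ℕtoℚ (m !)
      ≡⟨ tailProduct-tabulate w m suc ⟩
    prodℚ (tabulate (λ j → w (suc j) + ℕtoℚ (m ∸ toℕ j)))
      ≡⟨ cong prodℚ (LP.tabulate-cong λ j → cong (λ k → w (suc j) + ℕtoℚ k) (sym (shift j))) ⟩
    prodℚ (tabulate g)                                    ≡⟨ cong prodℚ (sym (LP.map-tabulate {n = m} id g)) ⟩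
    prodℚ (map g (allFin m))                              ∎
    where
    open ≡-Reasoning
    g = λ j → w (suc j) + ℕtoℚ ((suc m ℕ.+ 1) ∸ (toℕ j ℕ.+ 2))
    shift : ∀ j → (suc m ℕ.+ 1) ∸ (toℕ j ℕ.+ 2) ≡ m ∸ toℕ j
    shift j = cong₂ _∸_ (ℕP.+-comm (suc m) 1) (ℕP.+-comm (toℕ j) 2)

theorem1 : (n : ℕ) → 2 ≤ n → (w : Fin n → ℚ) → F n w ≡ RHS n w
theorem1 (suc m) _ w = begin
  F (suc m) w
    ≡⟨ foldr-expect (weight w) (λ _ _ _ → refl) (process (suc m)) ⟩
  expect (process (suc m)) (weight w)
    ≡⟨ expect-process ⟩
  c * (1ℚ + a * S)
    ≡⟨ solve 3 (λ c a S → c :* (con 1ℚ :+ a :* S) := (con 1ℚ :- a) :* c :+ a :* c :* (con 1ℚ :+ S)) refl c a S ⟩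
  (1ℚ - a) * c + a * c * (1ℚ + S)
    ≡⟨ cong₂ (λ x y → (1ℚ - a) * c + a * x * y)
             (sym (1/[m*n]*n≡1/m (suc m) (m !) ⦃ it ⦄ ⦃ m !≢0 ⦄)) (sym (tailProduct≡1+tailSum w passengers)) ⟩
  (1ℚ - a) * c + a * (e * M) * P
    ≡⟨ solve 5 (λ c a e M P → (con 1ℚ :- a) :* c :+ a :* (e :* M) :* P := (con 1ℚ :- a) :* c :+ (a :* e) :* (P :* M))
               refl c a e M P ⟩
  (1ℚ - a) * c + (a * e) * (P * M)
    ≡⟨ cong (λ x → (1ℚ - a) * c + (a * e) * x) tailProduct-passengers ⟩
  RHS (suc m) w ∎
  where
  open ≡-Reasoning
  open Boarding w
  a = w zero
  c = (+ 1) / suc m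
  e = _/_ (+ 1) (suc m !) ⦃ suc m !≢0 ⦄
  M = ℕtoℚ (m !)
  S = tailSum w passengers
  P = tailProduct w passengers
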